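{- Let $l\geq 1$, $n\geq 2$ and $k\geq 3$ be integers and let $G=B_l(n,k)$. Then $G$ has an equitable $\omega(G)$-coloring.
   Context: A clique is a maximal complete subgraph; $\omega(G)$ is the size of a largest clique. A simplicial vertex is a vertex belonging to exactly one clique of the graph. The graphs $B_l(n,k)$ are defined recursively: $B_1(n,k)$ is the complete graph $K_n$; for $l\geq 2$, $B_l(n,k)$ is obtained from $B_{l-1}(n,k)$ by attaching, to each simplicial vertex $u$ of $B_{l-1}(n,k)$, $k-1$ new cliques of size $n$, each consisting of $u$ together with $n-1$ new vertices (all new vertices distinct). An equitable $t$-coloring is a proper vertex coloring with colors $\{1,\dots,t\}$ in which every color class has size $\lfloor |V(G)|/t\rfloor$ or $\lceil |V(G)|/t\rceil$. -}

module Defs where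

open import Data.Nat using (ℕ; zero; suc; _+_; _*_; _∸_; _/_; _≤_)
open import Data.Fin using (Fin; splitAt; remQuot; _↑ʳ_)
open import Data.Fin.Subset using (Subset; _∈_; _⊆_; ∣_∣)
open import Data.Vec using (tabulate)
open import Data.Bool using (Bool)
open import Data.Sum using (_⊎_; inj₁; inj₂)
open import Data.Product using (Σ; _×_; _,_; proj₁; proj₂)
open import Relation.Binary.PropositionalEquality using (_≡_; _≢_)
open import Relation.Nullary.Decidable using (⌊_⌋)
open import Data.Fin using (_≟_)

record Graph : Set₁ where
  field
    N   : ℕ
    Adj : Fin N → Fin N → Set

open Graph public

module _ (G : Graph) where

  Complete : Subset (N G) → Set
  Complete S = ∀ x y → x ∈ S → y ∈ S → x ≢ y → Adj G x y

  IsClique : Subset (N G) → Set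
  IsClique S = Complete S × (∀ T → S ⊆ T → Complete T → T ⊆ S)

  IsCliqueNumber : ℕ → Set
  IsCliqueNumber w =
    Σ (Subset (N G)) (λ S → IsClique S × ∣ S ∣ ≡ w)
    × (∀ S → IsClique S → ∣ S ∣ ≤ w)

  IsSimplicial : Fin (N G) → Set
  IsSimplicial v =
    Σ (Subset (N G)) (λ S → IsClique S × v ∈ S
      × (∀ T → IsClique T → v ∈ T → T ≡ S))

  IsProper : {t : ℕ} → (Fin (N G) → Fin t) → Set
  IsProper c = ∀ x y → Adj G x y → c x ≢ c y

  colourClass : {t : ℕ} → (Fin (N G) → Fin t) → Fin t → Subset (N G)
  colourClass c i = tabulate (λ v → ⌊ c v ≟ i ⌋)

-- ⌊ a / t ⌋ and ⌈ a / t ⌉ (value at t = 0 irrelevant: no colour classes)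
floorDiv : ℕ → ℕ → ℕ
floorDiv a zero    = 0
floorDiv a (suc t) = a / suc t

ceilDiv : ℕ → ℕ → ℕ
ceilDiv a zero    = 0
ceilDiv a (suc t) = (a + t) / suc t

HasEquitableColouring : (G : Graph) → ℕ → Set
HasEquitableColouring G t =
  Σ (Fin (N G) → Fin t) λ c →
    IsProper G c ×
    (∀ i → ∣ colourClass G c i ∣ ≡ floorDiv (N G) t
         ⊎ ∣ colourClass G c i ∣ ≡ ceilDiv (N G) t)

-- Index m stands for l = m + 1.
-- Vertices of level 0 are those of K_n.  At step m → m+1 the new vertices
-- are triples (u , j , i) with u a simplicial vertex of the previous graph,
-- j : Fin (k-1) the attached clique, i : Fin (n-1) the new vertex in it.
-- The simplicial vertices of B_1 are all its vertices, and those of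
-- B_{l} (l ≥ 2) are exactly the vertices added in the last step; these are the "leaves" below.

module _ (n k : ℕ) where

  L : ℕ → ℕ
  L zero    = n
  L (suc m) = L m * ((k ∸ 1) * (n ∸ 1))

  V : ℕ → ℕ
  V zero    = n
  V (suc m) = V m + L (suc m)

  leaf : (m : ℕ) → Fin (L m) → Fin (V m)
  leaf zero    u = u
  leaf (suc m) u = V m ↑ʳ u

  anchor : (m : ℕ) → Fin (L (suc m)) → Fin (L m)
  anchor m x = proj₁ (remQuot {L m} ((k ∸ 1) * (n ∸ 1)) x)

  cliqueNo : (m : ℕ) → Fin (L (suc m)) → Fin (k ∸ 1)
  cliqueNo m x = proj₁ (remQuot {k ∸ 1} (n ∸ 1) (proj₂ (remQuot {L m} ((k ∸ 1) * (n ∸ 1)) x)))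

  posNo : (m : ℕ) → Fin (L (suc m)) → Fin (n ∸ 1)
  posNo m x = proj₂ (remQuot {k ∸ 1} (n ∸ 1) (proj₂ (remQuot {L m} ((k ∸ 1) * (n ∸ 1)) x)))

  AdjB : (m : ℕ) → Fin (V m) → Fin (V m) → Set
  AdjB zero x y = x ≢ y
  AdjB (suc m) x y = go (splitAt (V m) x) (splitAt (V m) y)
    where
    go : Fin (V m) ⊎ Fin (L (suc m)) → Fin (V m) ⊎ Fin (L (suc m)) → Set
    go (inj₁ a) (inj₁ b) = AdjB m a b
    go (inj₁ a) (inj₂ z) = a ≡ leaf m (anchor m z)
    go (inj₂ z) (inj₁ b) = b ≡ leaf m (anchor m z)
    go (inj₂ z) (inj₂ z') =
      anchor m z ≡ anchor m z' × cliqueNo m z ≡ cliqueNo m z' × posNo m z ≢ posNo m z'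

  Bgraph : ℕ → Graph
  Bgraph m = record { N = V m ; Adj = AdjB m }

B : (l n k : ℕ) → 1 ≤ l → Graph
B (suc m) n k _ = Bgraph n k m

-- Colour the root K_n with all n colours, and give the n − 1 new vertices of
-- each clique attached at a leaf u the n − 1 colours other than that of u;
-- this is a proper n-colouring.  If every colour occurs L/n times among the L
-- leaves, then a colour a occurs k − 1 times next to each of the L − L/n
-- leaves not coloured a, so it is again equidistributed among the new leaves.
-- By induction every colour class has exactly |V|/n vertices.  A proper
-- n-colouring bounds every complete set by n, so the root K_n is a maximum
-- clique and ω = n.
module Submission where

open import Defs
open import Algebra.Properties.Semiring.Sum using ()
open import Data.Bool using (Bool; true; false; if_then_else_)
open import Data.Fin using (Fin; zero; suc; splitAt; remQuot; punchIn; punchOut; _≟_)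
open import Data.Fin.Properties using (suc-injective; 0≢1+n; splitAt-↑ʳ; splitAt⁻¹-↑ˡ;
  punchInᵢ≢i; punchIn-injective; punchOut-injective)
open import Data.Fin.Subset using (Subset; inside; outside; _∈_; _⊆_; ∣_∣)
open import Data.Fin.Subset.Properties using (_∈?_; p⊂q⇒∣p∣<∣q∣)
open import Data.Nat using (ℕ; zero; suc; _+_; _*_; _∸_; _≤_; _/_; z≤n; s≤s)
open import Data.Nat.DivMod using (m*n/n≡m)
open import Data.Nat.Properties using (+-*-semiring; +-assoc; +-comm; +-identityʳ;
  *-zeroʳ; *-identityˡ; *-identityʳ; *-distribˡ-+; *-distribʳ-+; +-cancelʳ-≡;
  ≤-trans; ≤-reflexive; <⇒≱)
open import Data.Nat.Solver using (module +-*-Solver)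
open import Data.Product using (Σ; _×_; _,_; proj₁; proj₂)
open import Data.Sum using (_⊎_; inj₁; inj₂; [_,_]′; map₁)
open import Data.Vec using ([]; _∷_; tabulate; here; there)
open import Data.Vec.Properties using (lookup∘tabulate; []=⇒lookup)
open import Function using (id; _∘_; const)
open import Relation.Binary.PropositionalEquality
open import Relation.Nullary using (yes; no; contradiction)
open import Relation.Nullary.Decidable using (⌊_⌋; decidable-stable)

open Algebra.Properties.Semiring.Sum +-*-semiring
  using (sum-syntax; sum-cong-≗; ∑-distrib-+; sum-remove; *-distribˡ-sum)
open +-*-Solver using (solve; _:+_; _:*_; _:=_; con)

𝟙 : Bool → ℕ
𝟙 b = if b then 1 else 0

count : ∀ {N} → (Fin N → Bool) → ℕ
count {N} p = ∑[ x < N ] 𝟙 (p x)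

fibreSize : ∀ {N t} → (Fin N → Fin t) → Fin t → ℕ
fibreSize c a = count (λ x → ⌊ c x ≟ a ⌋)

∑-const : ∀ N x → ∑[ i < N ] x ≡ N * x
∑-const zero    x = refl
∑-const (suc N) x = cong (x +_) (∑-const N x)

∑-splitAt : ∀ a {b} (f : Fin a ⊎ Fin b → ℕ) →
  ∑[ x < a + b ] f (splitAt a x) ≡ ∑[ i < a ] f (inj₁ i) + ∑[ j < b ] f (inj₂ j)
∑-splitAt zero    f = refl
∑-splitAt (suc a) f =
  trans (cong (f (inj₁ zero) +_) (∑-splitAt a (f ∘ map₁ suc)))
        (sym (+-assoc (f (inj₁ zero)) (∑[ i < a ] f (inj₁ (suc i))) (∑[ j < _ ] f (inj₂ j))))

∑-remQuot : ∀ a {b} (f : Fin a → Fin b → ℕ) →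
  ∑[ x < a * b ] f (proj₁ (remQuot {a} b x)) (proj₂ (remQuot {a} b x)) ≡ ∑[ i < a ] ∑[ j < b ] f i j
∑-remQuot zero    f = refl
∑-remQuot (suc a) {b} f =
  trans (sum-cong-≗ by-block)
        (trans (∑-splitAt b [ f zero , g ]′)
               (cong (∑[ j < b ] f zero j +_) (∑-remQuot a (f ∘ suc))))
  where
  g : Fin (a * b) → ℕ
  g y = f (suc (proj₁ (remQuot {a} b y))) (proj₂ (remQuot {a} b y))
  by-block : ∀ x → f (proj₁ (remQuot {suc a} b x)) (proj₂ (remQuot {suc a} b x))
                   ≡ [ f zero , g ]′ (splitAt b x)
  by-block x with splitAt b x
  ... | inj₁ _ = refl
  ... | inj₂ _ = refl

count-false : ∀ N → count {N} (const false) ≡ 0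
count-false N = trans (∑-const N 0) (*-zeroʳ N)

∣tabulate∣≡count : ∀ {N} (p : Fin N → Bool) → ∣ tabulate p ∣ ≡ count p
∣tabulate∣≡count {zero}  p = refl
∣tabulate∣≡count {suc N} p with p zero
... | true  = cong suc (∣tabulate∣≡count (p ∘ suc))
... | false = ∣tabulate∣≡count (p ∘ suc)

∈-tabulate⁻ : ∀ {N} {p : Fin N → Bool} {x} → x ∈ tabulate p → p x ≡ true
∈-tabulate⁻ {p = p} {x} x∈ = trans (sym (lookup∘tabulate p x)) ([]=⇒lookup x∈)

fibreSize-cong : ∀ {N t} {c c′ : Fin N → Fin t} → c ≗ c′ → ∀ a → fibreSize c a ≡ fibreSize c′ a
fibreSize-cong c≗c′ a = sum-cong-≗ (λ x → cong (λ b → 𝟙 ⌊ b ≟ a ⌋) (c≗c′ x))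

fibreSize-id : ∀ {N} (a : Fin N) → fibreSize id a ≡ 1
fibreSize-id {suc N} a = begin
  fibreSize id a                         ≡⟨ sum-remove {i = a} (λ x → 𝟙 ⌊ x ≟ a ⌋) ⟩
  𝟙 ⌊ a ≟ a ⌋ + fibreSize (punchIn a) a  ≡⟨ cong₂ _+_ hit (sum-cong-≗ miss) ⟩
  1 + ∑[ i < N ] 0                       ≡⟨ cong suc (count-false N) ⟩
  1                                      ∎
  where
  open ≡-Reasoning
  hit : 𝟙 ⌊ a ≟ a ⌋ ≡ 1
  hit with a ≟ a
  ... | yes _   = refl
  ... | no  a≢a = contradiction refl a≢a
  miss : ∀ i → 𝟙 ⌊ punchIn a i ≟ a ⌋ ≡ 0
  miss i with punchIn a i ≟ a
  ... | yes eq = contradiction eq (punchInᵢ≢i a i)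
  ... | no  _  = refl

fibreSize-punchIn : ∀ {N} (b a : Fin (suc N)) → fibreSize (punchIn b) a + 𝟙 ⌊ b ≟ a ⌋ ≡ 1
fibreSize-punchIn b a = begin
  fibreSize (punchIn b) a + 𝟙 ⌊ b ≟ a ⌋  ≡⟨ +-comm (fibreSize (punchIn b) a) _ ⟩
  𝟙 ⌊ b ≟ a ⌋ + fibreSize (punchIn b) a  ≡⟨ sum-remove {i = b} (λ x → 𝟙 ⌊ x ≟ a ⌋) ⟨
  fibreSize id a                         ≡⟨ fibreSize-id a ⟩
  1                                      ∎
  where open ≡-Reasoning

injectiveOn⇒∣p∣≤ : ∀ {N t} (p : Subset N) (g : ∀ {x} → x ∈ p → Fin t) →
  (∀ {x y} (x∈p : x ∈ p) (y∈p : y ∈ p) → g x∈p ≡ g y∈p → x ≡ y) → ∣ p ∣ ≤ t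
injectiveOn⇒∣p∣≤ []            g inj = z≤n
injectiveOn⇒∣p∣≤ (outside ∷ p) g inj =
  injectiveOn⇒∣p∣≤ p (g ∘ there) (λ x∈p y∈p → suc-injective ∘ inj (there x∈p) (there y∈p))
injectiveOn⇒∣p∣≤ {t = zero}  (inside ∷ p) g inj with () ← g here
injectiveOn⇒∣p∣≤ {t = suc t} (inside ∷ p) g inj = s≤s (injectiveOn⇒∣p∣≤ p g′ inj′)
  where
  g₀≢ : ∀ {x} (x∈p : x ∈ p) → g here ≢ g (there x∈p)
  g₀≢ x∈p = 0≢1+n ∘ inj here (there x∈p)
  g′ : ∀ {x} → x ∈ p → Fin t
  g′ x∈p = punchOut (g₀≢ x∈p)
  inj′ : ∀ {x y} (x∈p : x ∈ p) (y∈p : y ∈ p) → g′ x∈p ≡ g′ y∈p → x ≡ y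
  inj′ x∈p y∈p =
    suc-injective ∘ inj (there x∈p) (there y∈p) ∘ punchOut-injective (g₀≢ x∈p) (g₀≢ y∈p)

module _ (G : Graph) {t : ℕ} {c : Fin (N G) → Fin t} (proper : IsProper G c) where

  complete⇒∣S∣≤colours : ∀ S → Complete G S → ∣ S ∣ ≤ t
  complete⇒∣S∣≤colours S complete = injectiveOn⇒∣p∣≤ S (λ {x} _ → c x) injective
    where
    injective : ∀ {x y} → x ∈ S → y ∈ S → c x ≡ c y → x ≡ y
    injective {x} {y} x∈S y∈S cx≡cy =
      decidable-stable (x ≟ y) (λ x≢y → proper x y (complete x y x∈S y∈S x≢y) cx≡cy)

  complete∧∣S∣≡colours⇒isClique : ∀ S → Complete G S → ∣ S ∣ ≡ t → IsClique G S
  complete∧∣S∣≡colours⇒isClique S complete ∣S∣≡t = complete , maximal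
    where
    maximal : ∀ T → S ⊆ T → Complete G T → T ⊆ S
    maximal T S⊆T completeT {x} x∈T with x ∈? S
    ... | yes x∈S = x∈S
    ... | no  x∉S = contradiction
      (≤-trans (complete⇒∣S∣≤colours T completeT) (≤-reflexive (sym ∣S∣≡t)))
      (<⇒≱ (p⊂q⇒∣p∣<∣q∣ (S⊆T , x , x∈T , x∉S)))

  isCliqueNumber-colours : ∀ S → Complete G S → ∣ S ∣ ≡ t → IsCliqueNumber G t
  isCliqueNumber-colours S complete ∣S∣≡t =
    (S , complete∧∣S∣≡colours⇒isClique S complete ∣S∣≡t , ∣S∣≡t) ,
    λ T clique → complete⇒∣S∣≤colours T (proj₁ clique)

balanced⇒equitable : ∀ G {t} {c : Fin (N G) → Fin (suc t)} d → IsProper G c →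
  N G ≡ d * suc t → (∀ a → fibreSize c a ≡ d) → HasEquitableColouring G (suc t)
balanced⇒equitable G {t} {c} d proper N≡d*t balanced = c , proper , λ a →
  inj₁ (begin
    ∣ colourClass G c a ∣  ≡⟨ ∣tabulate∣≡count (λ v → ⌊ c v ≟ a ⌋) ⟩
    fibreSize c a          ≡⟨ balanced a ⟩
    d                      ≡⟨ m*n/n≡m d (suc t) ⟨
    d * suc t / suc t      ≡⟨ cong (_/ suc t) N≡d*t ⟨
    N G / suc t            ∎)
  where open ≡-Reasoning

module Colouring (p k : ℕ) where

  private
    n q : ℕ
    n = suc p
    q = k ∸ 1

  newColour : (m : ℕ) → (Fin (V n k m) → Fin n) → Fin (L n k (suc m)) → Fin n
  newColour m c z = punchIn (c (leaf n k m (anchor n k m z))) (posNo n k m z)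

  extendColouring : (m : ℕ) → (Fin (V n k m) → Fin n) → Fin (V n k (suc m)) → Fin n
  extendColouring m c x = [ c , newColour m c ]′ (splitAt (V n k m) x)

  colour : (m : ℕ) → Fin (V n k m) → Fin n
  colour zero    = id
  colour (suc m) = extendColouring m (colour m)

  extendColouring-proper : ∀ m {c} → IsProper (Bgraph n k m) c →
    IsProper (Bgraph n k (suc m)) (extendColouring m c)
  extendColouring-proper m {c} proper x y adj with splitAt (V n k m) x | splitAt (V n k m) y
  ... | inj₁ a | inj₁ b = proper a b adj
  ... | inj₁ a | inj₂ z rewrite adj = punchInᵢ≢i _ _ ∘ sym
  ... | inj₂ z | inj₁ b rewrite adj = punchInᵢ≢i _ _
  ... | inj₂ z | inj₂ z′ with sameAnchor , _ , differentPos ← adj rewrite sameAnchor =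
    differentPos ∘ punchIn-injective _ _ _

  colour-proper : ∀ m → IsProper (Bgraph n k m) (colour m)
  colour-proper zero    x y x≢y = x≢y
  colour-proper (suc m) = extendColouring-proper m (colour-proper m)

  fibreSize-newColour-byLeaf : ∀ m c a →
    fibreSize (newColour m c) a ≡ q * ∑[ u < L n k m ] fibreSize (punchIn (c (leaf n k m u))) a
  fibreSize-newColour-byLeaf m c a = begin
    fibreSize (newColour m c) a
      ≡⟨ ∑-remQuot (L n k m) (λ u w → 𝟙 ⌊ punchIn (c′ u) (proj₂ (remQuot {q} p w)) ≟ a ⌋) ⟩
    ∑[ u < L n k m ] ∑[ w < q * p ] 𝟙 ⌊ punchIn (c′ u) (proj₂ (remQuot {q} p w)) ≟ a ⌋
      ≡⟨ sum-cong-≗ (λ u → ∑-remQuot q (λ _ i → 𝟙 ⌊ punchIn (c′ u) i ≟ a ⌋)) ⟩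
    ∑[ u < L n k m ] ∑[ j < q ] fibreSize (punchIn (c′ u)) a
      ≡⟨ sum-cong-≗ (λ u → ∑-const q (fibreSize (punchIn (c′ u)) a)) ⟩
    ∑[ u < L n k m ] (q * fibreSize (punchIn (c′ u)) a)
      ≡⟨ *-distribˡ-sum q (λ u → fibreSize (punchIn (c′ u)) a) ⟨
    q * ∑[ u < L n k m ] fibreSize (punchIn (c′ u)) a
      ∎
    where
    open ≡-Reasoning
    c′ : Fin (L n k m) → Fin n
    c′ = c ∘ leaf n k m

  fibreSize-newColour : ∀ m c a →
    fibreSize (newColour m c) a + q * fibreSize (c ∘ leaf n k m) a ≡ q * L n k m
  fibreSize-newColour m c a = begin
    fibreSize (newColour m c) a + q * fibreSize c′ a
      ≡⟨ cong (_+ q * fibreSize c′ a) (fibreSize-newColour-byLeaf m c a) ⟩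
    q * ∑[ u < L n k m ] fibreSize (punchIn (c′ u)) a + q * fibreSize c′ a
      ≡⟨ *-distribˡ-+ q _ (fibreSize c′ a) ⟨
    q * (∑[ u < L n k m ] fibreSize (punchIn (c′ u)) a + fibreSize c′ a)
      ≡⟨ cong (q *_) (∑-distrib-+ (λ u → fibreSize (punchIn (c′ u)) a) (λ u → 𝟙 ⌊ c′ u ≟ a ⌋)) ⟨
    q * ∑[ u < L n k m ] (fibreSize (punchIn (c′ u)) a + 𝟙 ⌊ c′ u ≟ a ⌋)
      ≡⟨ cong (q *_) (sum-cong-≗ (λ u → fibreSize-punchIn (c′ u) a)) ⟩
    q * ∑[ u < L n k m ] 1
      ≡⟨ cong (q *_) (trans (∑-const (L n k m) 1) (*-identityʳ (L n k m))) ⟩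
    q * L n k m
      ∎
    where
    open ≡-Reasoning
    c′ : Fin (L n k m) → Fin n
    c′ = c ∘ leaf n k m

  fibreSize-extendColouring : ∀ m c a →
    fibreSize (extendColouring m c) a ≡ fibreSize c a + fibreSize (newColour m c) a
  fibreSize-extendColouring m c a = ∑-splitAt (V n k m) (λ s → 𝟙 ⌊ [ c , newColour m c ]′ s ≟ a ⌋)

  extendColouring-leaf : ∀ m c z → extendColouring m c (leaf n k (suc m) z) ≡ newColour m c z
  extendColouring-leaf m c z = cong [ c , newColour m c ]′ (splitAt-↑ʳ (V n k m) (L n k (suc m)) z)

  leavesPerColour : ℕ → ℕ
  leavesPerColour zero    = 1
  leavesPerColour (suc m) = leavesPerColour m * (q * p)

  verticesPerColour : ℕ → ℕ
  verticesPerColour zero    = 1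
  verticesPerColour (suc m) = verticesPerColour m + leavesPerColour (suc m)

  L≡leavesPerColour*n : ∀ m → L n k m ≡ leavesPerColour m * n
  L≡leavesPerColour*n zero    = sym (*-identityˡ n)
  L≡leavesPerColour*n (suc m) = begin
    L n k m * (q * p)  ≡⟨ cong (_* (q * p)) (L≡leavesPerColour*n m) ⟩
    E * n * (q * p)    ≡⟨ solve 3 (λ e n r → e :* n :* r := e :* r :* n) refl E n (q * p) ⟩
    E * (q * p) * n    ∎
    where
    open ≡-Reasoning
    E : ℕ
    E = leavesPerColour m

  V≡verticesPerColour*n : ∀ m → V n k m ≡ verticesPerColour m * n
  V≡verticesPerColour*n zero    = sym (*-identityˡ n)
  V≡verticesPerColour*n (suc m) =
    trans (cong₂ _+_ (V≡verticesPerColour*n m) (L≡leavesPerColour*n (suc m)))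
          (sym (*-distribʳ-+ n (verticesPerColour m) (leavesPerColour (suc m))))

  newColour-balanced : ∀ m c → (∀ a → fibreSize (c ∘ leaf n k m) a ≡ leavesPerColour m) →
    ∀ a → fibreSize (newColour m c) a ≡ leavesPerColour (suc m)
  newColour-balanced m c leaves-balanced a = +-cancelʳ-≡ (q * E) _ _ (begin
    fibreSize (newColour m c) a + q * E
      ≡⟨ cong (λ e → fibreSize (newColour m c) a + q * e) (leaves-balanced a) ⟨
    fibreSize (newColour m c) a + q * fibreSize (c ∘ leaf n k m) a
      ≡⟨ fibreSize-newColour m c a ⟩
    q * L n k m
      ≡⟨ cong (q *_) (L≡leavesPerColour*n m) ⟩
    q * (E * suc p)
      ≡⟨ solve 3 (λ q e p → q :* (e :* (con 1 :+ p)) := e :* (q :* p) :+ q :* e) refl q E p ⟩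
    E * (q * p) + q * E
      ∎)
    where
    open ≡-Reasoning
    E : ℕ
    E = leavesPerColour m

  leafColour-balanced : ∀ m a → fibreSize (colour m ∘ leaf n k m) a ≡ leavesPerColour m
  leafColour-balanced zero    a = fibreSize-id a
  leafColour-balanced (suc m) a =
    trans (fibreSize-cong (extendColouring-leaf m (colour m)) a)
          (newColour-balanced m (colour m) (leafColour-balanced m) a)

  colour-balanced : ∀ m a → fibreSize (colour m) a ≡ verticesPerColour m
  colour-balanced zero    a = fibreSize-id a
  colour-balanced (suc m) a =
    trans (fibreSize-extendColouring m (colour m) a)
          (cong₂ _+_ (colour-balanced m a)
                     (newColour-balanced m (colour m) (leafColour-balanced m) a))

  isRoot : (m : ℕ) → Fin (V n k m) → Bool
  isRoot zero    _ = true
  isRoot (suc m) x = [ isRoot m , const false ]′ (splitAt (V n k m) x)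

  rootClique : (m : ℕ) → Subset (V n k m)
  rootClique m = tabulate (isRoot m)

  isRoot-adjacent : ∀ m {x y} → isRoot m x ≡ true → isRoot m y ≡ true → x ≢ y → AdjB n k m x y
  isRoot-adjacent zero    _ _ x≢y = x≢y
  isRoot-adjacent (suc m) {x} {y} rx ry x≢y
    with splitAt (V n k m) x in eqx | splitAt (V n k m) y in eqy
  ... | inj₁ a | inj₁ b = isRoot-adjacent m rx ry (x≢y ∘ a≡b⇒x≡y)
    where
    a≡b⇒x≡y : a ≡ b → x ≡ y
    a≡b⇒x≡y refl = trans (sym (splitAt⁻¹-↑ˡ eqx)) (splitAt⁻¹-↑ˡ eqy)
  ... | inj₁ _ | inj₂ _ with () ← ry
  ... | inj₂ _ | _      with () ← rx

  rootClique-complete : ∀ m → Complete (Bgraph n k m) (rootClique m)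
  rootClique-complete m x y x∈ y∈ = isRoot-adjacent m (∈-tabulate⁻ x∈) (∈-tabulate⁻ y∈)

  count-isRoot : ∀ m → count (isRoot m) ≡ n
  count-isRoot zero    = trans (∑-const n 1) (*-identityʳ n)
  count-isRoot (suc m) =
    trans (∑-splitAt (V n k m) (λ s → 𝟙 ([ isRoot m , const false ]′ s)))
          (trans (cong₂ _+_ (count-isRoot m) (count-false (L n k (suc m)))) (+-identityʳ n))

  ∣rootClique∣≡n : ∀ m → ∣ rootClique m ∣ ≡ n
  ∣rootClique∣≡n m = trans (∣tabulate∣≡count (isRoot m)) (count-isRoot m)

theorem4 : (l n k : ℕ) (hl : 1 ≤ l) → 2 ≤ n → 3 ≤ k →
    Σ ℕ (λ w → IsCliqueNumber (B l n k hl) w × HasEquitableColouring (B l n k hl) w)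
theorem4 (suc m) (suc p) k _ _ _ = suc p , cliqueNumber , equitable
  where
  open Colouring p k
  G : Graph
  G = Bgraph (suc p) k m
  cliqueNumber : IsCliqueNumber G (suc p)
  cliqueNumber =
    isCliqueNumber-colours G (colour-proper m)
      (rootClique m) (rootClique-complete m) (∣rootClique∣≡n m)
  equitable : HasEquitableColouring G (suc p)
  equitable =
    balanced⇒equitable G (verticesPerColour m) (colour-proper m)
      (V≡verticesPerColour*n m) (colour-balanced m)
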